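{- Let $P:\{ -1,1\}^k \to \{0,1\}$ be a predicate, let $1 \le t \le k$, and let $0 < \delta < 1$. Then $P$ is $\delta$-far from $t$-wise-uniform-supporting if and only if there exists a $\delta$-separating polynomial for $P$ of degree at most $t$.
   Context: A probability distribution $\mathcal{D}$ on $\{ -1,1\}^k$ is $t$-wise uniform if for every $S \subseteq [k]$ with $|S| = t$, the restriction $x_S = (x_i)_{i \in S}$ is uniformly distributed on $\{ -1,1\}^t$ when $x \sim \mathcal{D}$. The predicate $P$ is $\delta$-far from $t$-wise-uniform-supporting if every $t$-wise uniform distribution on $\{ -1,1\}^k$ puts probability mass at least $\delta$ on $P^{ -1}(0)$. Every function $Q:\{ -1,1\}^k\to\mathbb{R}$ has a unique multilinear expansion $Q(z)=\sum_{S\subseteq[k]}\widehat{Q}(S) z^S$ with $z^S=\prod_{i\in S} z_i$. A multilinear polynomial $Q:\{ -1,1\}^k \to \mathbb{R}$ is $\delta$-separating for $P$ if (i) $Q(z) \ge \delta - 1$ for all $z \in \{ -1,1\}^k$; (ii) $Q(z) \ge \delta$ for all $z \in P^{ -1}(1)$; (iii) $\widehat{Q}(\emptyset) = 0$.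
   Formalization: The parameter δ, the probabilities of the t-wise uniform distributions and the coefficients of the separating polynomials are rational rather than real. -}

module Defs where

open import Data.Nat using (ℕ; zero; suc)
open import Data.Bool using (Bool; true; false; if_then_else_; _∧_)
open import Data.Sign using (Sign) renaming (- to minus; + to plus)
open import Data.Vec using (Vec; []; _∷_)
open import Data.List using (List; []; _∷_; map; concatMap; foldr)
open import Data.Rational using (ℚ; 0ℚ; 1ℚ; ½; _+_; _*_; -_; _-_; _≤_)
open import Data.Fin.Subset using (Subset; inside; outside; ⊥; ∣_∣)
open import Relation.Binary.PropositionalEquality using (_≡_)
open import Data.Product using (_×_; Σ)
open import Data.Nat using () renaming (_<_ to _<ℕ_)

Point : ℕ → Set
Point k = Vec Sign k

sgn : Sign → ℚ
sgn minus = -_ 1ℚ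
sgn plus = 1ℚ

allVecs : {A : Set} → List A → (k : ℕ) → List (Vec A k)
allVecs xs zero = [] ∷ []
allVecs xs (suc k) = concatMap (λ x → map (x ∷_) (allVecs xs k)) xs

allPoints : (k : ℕ) → List (Point k)
allPoints = allVecs (minus ∷ plus ∷ [])

allSubsets : (k : ℕ) → List (Subset k)
allSubsets = allVecs (outside ∷ inside ∷ [])

sumℚ : List ℚ → ℚ
sumℚ = foldr _+_ 0ℚ

Σpts : (k : ℕ) → (Point k → ℚ) → ℚ
Σpts k f = sumℚ (map f (allPoints k))

½^ : ℕ → ℚ
½^ zero = 1ℚ
½^ (suc t) = ½ * ½^ t

record Distribution (k : ℕ) : Set where
  field
    prob    : Point k → ℚ
    nonneg  : ∀ x → 0ℚ ≤ prob x
    sum-one : Σpts k prob ≡ 1ℚ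
open Distribution public

agreeOn : {k : ℕ} → Subset k → Point k → Point k → Bool
agreeOn [] [] [] = true
agreeOn (outside ∷ S) (x ∷ xs) (a ∷ as) = agreeOn S xs as
agreeOn (inside ∷ S) (minus ∷ xs) (minus ∷ as) = agreeOn S xs as
agreeOn (inside ∷ S) (plus ∷ xs) (plus ∷ as) = agreeOn S xs as
agreeOn (inside ∷ S) (minus ∷ xs) (plus ∷ as) = false
agreeOn (inside ∷ S) (plus ∷ xs) (minus ∷ as) = false

Pr : {k : ℕ} → Distribution k → (Point k → Bool) → ℚ
Pr {k} D E = Σpts k (λ x → if E x then prob D x else 0ℚ)

-- t-wise uniform: for every S with |S| = t, x_S is uniform on {-1,1}^S,
-- i.e. every pattern on S (given as the restriction of some a) has
-- probability 2^{-t}.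
TWiseUniform : {k : ℕ} → ℕ → Distribution k → Set
TWiseUniform {k} t D =
  ∀ (S : Subset k) → ∣ S ∣ ≡ t → ∀ (a : Point k) →
    Pr D (agreeOn S a) ≡ ½^ t

-- Predicates P : {-1,1}^k → {0,1}, with 0 = false and 1 = true.
Predicate : ℕ → Set
Predicate k = Point k → Bool

not? : Bool → Bool
not? true = false
not? false = true

DeltaFar : {k : ℕ} → Predicate k → ℕ → ℚ → Set
DeltaFar {k} P t δ =
  ∀ (D : Distribution k) → TWiseUniform t D → δ ≤ Pr D (λ x → not? (P x))

-- Multilinear polynomials, given by their Fourier coefficients Q̂(S).

MultilinearPoly : ℕ → Set
MultilinearPoly k = Subset k → ℚ

monomial : {k : ℕ} → Subset k → Point k → ℚ
monomial [] [] = 1ℚ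
monomial (outside ∷ S) (z ∷ zs) = monomial S zs
monomial (inside ∷ S) (z ∷ zs) = sgn z * monomial S zs

eval : {k : ℕ} → MultilinearPoly k → Point k → ℚ
eval {k} Q z = sumℚ (map (λ S → Q S * monomial S z) (allSubsets k))

DegreeAtMost : {k : ℕ} → ℕ → MultilinearPoly k → Set
DegreeAtMost {k} t Q = ∀ (S : Subset k) → t <ℕ ∣ S ∣ → Q S ≡ 0ℚ

Separating : {k : ℕ} → Predicate k → ℚ → MultilinearPoly k → Set
Separating {k} P δ Q =
  (∀ (z : Point k) → δ - 1ℚ ≤ eval Q z) ×
  (∀ (z : Point k) → P z ≡ true → δ ≤ eval Q z) ×
  (Q ⊥ ≡ 0ℚ)

{-# OPTIONS --safe #-}
-- A δ-separating polynomial of degree ≤ t is a solution of a finite system of linear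
-- inequalities in its coefficients Q̂(T), 1 ≤ |T| ≤ t: one inequality Q(z) ≥ δ or
-- Q(z) ≥ δ - 1 for each point z of the cube. By Farkas' lemma (Fourier–Motzkin
-- elimination) either the system is solvable, or a nonnegative combination of its
-- inequalities is contradictory. The weights y(z) of such a combination annihilate
-- every monomial z^T with 1 ≤ |T| ≤ t, which for a measure on the cube is the same as
-- being t-wise uniform; normalised, they form a t-wise uniform distribution giving
-- P⁻¹(0) mass less than δ. Conversely, a separating Q has expectation 0 under every
-- t-wise uniform distribution, and its pointwise lower bounds turn this into
-- Pr[P = 0] ≥ δ.
module Submission where

open import Defs

-- opened locally: _≤_ is the order of ℚ here, and that of ℕ in the statement at the end
module _ where
  open import Data.Nat as ℕ using (ℕ; zero; suc; z≤n; s≤s)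
  import Data.Nat.Properties as ℕ
  open import Data.Rational
    using (ℚ; 0ℚ; 1ℚ; ½; _+_; _*_; -_; _-_; _≤_; _<_; 1/_; _⊔_; _⊓_; positive; nonNegative)
  open import Data.Rational.Properties
  open import Data.Rational.Solver using (module +-*-Solver)
  open +-*-Solver using (solve; _:+_; _:*_; :-_; _:-_; _:=_; con)
  open import Data.Bool using (Bool; true; false; if_then_else_)
  import Data.Bool.Properties as Bool
  open import Data.Sign using (Sign) renaming (- to minus; + to plus)
  import Data.Sign.Properties as Sign
  open import Data.Maybe using (Maybe; just; nothing)
  import Data.Maybe.Properties as Maybe
  open import Data.Empty using (⊥-elim)
  open import Data.Product using (Σ; ∃; _×_; _,_; proj₁; proj₂; uncurry)
  open import Data.Sum using (_⊎_; inj₁; inj₂)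
  open import Data.Vec as V using (Vec; []; _∷_)
  import Data.Vec.Properties as V
  open import Data.Fin.Subset using (Subset; inside; outside; ⊥; ⊤; ∣_∣; _⊆_)
  open import Data.Fin.Subset.Properties
    using (⊆-refl; ⊆⊤; ∣⊤∣≡n; ∣⊥∣≡0; drop-∷-⊆; out⊆; in⊆in)
  open import Data.List as L using (List; []; _∷_; _++_)
  import Data.List.Properties as L
  open import Data.List.Membership.Propositional using (_∈_; _∉_; find)
  open import Data.List.Membership.Propositional.Properties
    using ( ∈-map⁺; ∈-map⁻; ∈-filter⁺; ∈-filter⁻; ∈-++⁺ˡ; ∈-++⁺ʳ; ∈-++⁻
          ; ∈-cartesianProductWith⁺; ∈-cartesianProductWith⁻)
  open import Data.List.Relation.Unary.All as All using (All; []; _∷_; all?)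
  import Data.List.Relation.Unary.All.Properties as All
  open import Data.List.Relation.Unary.Any using (here; there; index)
  open import Function using (_∘_)
  open import Relation.Nullary using (¬_; Dec; yes; no; does)
  open import Relation.Nullary.Decidable using (dec-true; dec-false; _×-dec_)
  open import Relation.Binary using (DecidableEquality; tri<; tri≈; tri>)
  open import Relation.Binary.PropositionalEquality

  -- Farkas' lemma

  p≤q⇒0≤q-p : ∀ {p q} → p ≤ q → 0ℚ ≤ q - p
  p≤q⇒0≤q-p {p} {q} p≤q = subst (_≤ q - p) (+-inverseʳ p) (+-monoˡ-≤ (- p) p≤q)

  0≤q-p⇒p≤q : ∀ {p q} → 0ℚ ≤ q - p → p ≤ q
  0≤q-p⇒p≤q {p} {q} 0≤q-p = subst₂ _≤_ (+-identityˡ p) q-p+p≡q (+-monoˡ-≤ p 0≤q-p)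
    where q-p+p≡q = solve 2 (λ q p → q :- p :+ p := q) refl q p

  ≤-by-slack : ∀ {u v w z} → z - w ≡ v - u → w ≤ z → u ≤ v
  ≤-by-slack eq w≤z = 0≤q-p⇒p≤q (subst (0ℚ ≤_) eq (p≤q⇒0≤q-p w≤z))

  *-nonNeg : ∀ {p q} → 0ℚ ≤ p → 0ℚ ≤ q → 0ℚ ≤ p * q
  *-nonNeg {p} {q} 0≤p 0≤q =
    nonNegative⁻¹ (p * q) {{nonNeg*nonNeg⇒nonNeg p {{nonNegative 0≤p}} q {{nonNegative 0≤q}}}}

  between : (ls us : List ℚ) → All (λ l → All (l ≤_) us) ls →
            ∃ λ x → All (_≤ x) ls × All (x ≤_) us
  between [] [] _ = 0ℚ , [] , []
  between [] (u ∷ us) _ =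
    let x , _ , x≤us = between [] us [] in
    u ⊓ x , [] , p⊓q≤p u x ∷ All.map (≤-trans (p⊓q≤q u x)) x≤us
  between (l ∷ ls) us (l≤us ∷ ls≤us) =
    let x , ls≤x , x≤us = between ls us ls≤us in
    l ⊔ x , p≤p⊔q l x ∷ All.map (λ ℓ≤x → ≤-trans ℓ≤x (p≤q⊔p l x)) ls≤x ,
    All.zipWith (uncurry ⊔-lub) (l≤us , x≤us)

  Constraint : ℕ → Set
  Constraint n = Vec ℚ n × ℚ

  infixl 7 _∙_
  _∙_ : ∀ {n} → Vec ℚ n → Vec ℚ n → ℚ
  []       ∙ []       = 0ℚ
  (a ∷ as) ∙ (x ∷ xs) = a * x + as ∙ xs

  infix 4 _⊨_
  _⊨_ : ∀ {n} → Vec ℚ n → Constraint n → Set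
  q ⊨ (a , b) = b ≤ a ∙ q

  _⊨?_ : ∀ {n} (q : Vec ℚ n) c → Dec (q ⊨ c)
  q ⊨? (a , b) = b ≤? a ∙ q

  infixl 6 _⊕_
  _⊕_ : ∀ {n} → Constraint n → Constraint n → Constraint n
  (a , b) ⊕ (a′ , b′) = V.zipWith _+_ a a′ , b + b′

  infixr 7 _⊛_
  _⊛_ : ∀ {n} → ℚ → Constraint n → Constraint n
  s ⊛ (a , b) = V.map (s *_) a , s * b

  ∙-distribʳ-+ : ∀ {n} (a a′ q : Vec ℚ n) → V.zipWith _+_ a a′ ∙ q ≡ a ∙ q + a′ ∙ q
  ∙-distribʳ-+ []       []         []       = refl
  ∙-distribʳ-+ (a ∷ as) (a′ ∷ as′) (x ∷ xs) rewrite ∙-distribʳ-+ as as′ xs =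
    solve 5 (λ a a′ x r r′ → (a :+ a′) :* x :+ (r :+ r′) := a :* x :+ r :+ (a′ :* x :+ r′))
      refl a a′ x (as ∙ xs) (as′ ∙ xs)

  ∙-*-assoc : ∀ {n} s (a q : Vec ℚ n) → V.map (s *_) a ∙ q ≡ s * (a ∙ q)
  ∙-*-assoc s []       []       = sym (*-zeroʳ s)
  ∙-*-assoc s (a ∷ as) (x ∷ xs) rewrite ∙-*-assoc s as xs =
    solve 4 (λ s a x r → s :* a :* x :+ s :* r := s :* (a :* x :+ r)) refl s a x (as ∙ xs)

  ⊛-identityˡ : ∀ {n} (c : Constraint n) → 1ℚ ⊛ c ≡ c
  ⊛-identityˡ (a , b) = cong₂ _,_ (trans (V.map-cong *-identityˡ a) (V.map-id a)) (*-identityˡ b)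

  ⊨-cancel-⊛ : ∀ {n} {q : Vec ℚ n} {s} c → 0ℚ < s → q ⊨ s ⊛ c → q ⊨ c
  ⊨-cancel-⊛ {q = q} {s} (a , b) s>0 sat =
    *-cancelˡ-≤-pos s {{positive s>0}} (subst (s * b ≤_) (∙-*-assoc s a q) sat)

  data Cone {n} (Cs : List (Constraint n)) : Constraint n → Set where
    gen   : ∀ {c} → c ∈ Cs → Cone Cs c
    _⊕ᶜ_  : ∀ {c d} → Cone Cs c → Cone Cs d → Cone Cs (c ⊕ d)
    scale : ∀ {c} s → 0ℚ ≤ s → Cone Cs c → Cone Cs (s ⊛ c)

  Feasible : ∀ {n} → List (Constraint n) → Set
  Feasible Cs = ∃ λ q → All (q ⊨_) Cs

  -- derives the inequality β ≤ 0 ∙ q = 0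
  Refutable : ∀ {n} → List (Constraint n) → Set
  Refutable {n} Cs = ∃ λ β → 0ℚ < β × Cone Cs (V.replicate n 0ℚ , β)

  farkas₀ : (Cs : List (Constraint 0)) → Feasible Cs ⊎ Refutable Cs
  farkas₀ Cs with all? ([] ⊨?_) Cs
  ... | yes sat = inj₁ ([] , sat)
  ... | no ¬sat with find (All.¬All⇒Any¬ ([] ⊨?_) Cs ¬sat)
  ...   | ([] , b) , c∈Cs , b≰0 = inj₂ (b , ≰⇒> b≰0 , gen c∈Cs)

  -- The coefficient of the unknown to be eliminated, normalised to its sign;
  -- nothing stands for the coefficient 0.
  coefficient : Maybe Sign → ℚ
  coefficient nothing  = 0ℚ
  coefficient (just s) = sgn s

  embed : ∀ {n} → Maybe Sign → Constraint n → Constraint (suc n)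
  embed σ (a , b) = coefficient σ ∷ a , b

  classify : ∀ {n} → Constraint (suc n) → Maybe Sign × Constraint n
  classify (h ∷ a , b) with <-cmp h 0ℚ
  ... | tri< h<0 _ _ = just minus , 1/ (- h) ⊛ (a , b)
    where instance -h≢0 = pos⇒nonZero (- h) {{positive (neg-antimono-< h<0)}}
  ... | tri≈ _ _ _   = nothing , (a , b)
  ... | tri> _ _ h>0 = just plus , 1/ h ⊛ (a , b)
    where instance h≢0 = pos⇒nonZero h {{positive h>0}}

  classify-positiveMultiple : ∀ {n} (c : Constraint (suc n)) →
                              ∃ λ s → 0ℚ < s × uncurry embed (classify c) ≡ s ⊛ c
  classify-positiveMultiple (h ∷ a , b) with <-cmp h 0ℚ
  ... | tri< h<0 _ _ = s , positive⁻¹ s , cong (λ z → z ∷ V.map (s *_) a , s * b) (sym s*h≡-1)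
    where
    instance
      -h-pos = positive (neg-antimono-< h<0)
      -h≢0   = pos⇒nonZero (- h)
      s-pos  = 1/pos⇒pos (- h)
    s = 1/ (- h)
    s*h≡-1 : s * h ≡ - 1ℚ
    s*h≡-1 = trans (solve 2 (λ s h → s :* h := :- (s :* (:- h))) refl s h) (cong -_ (*-inverseˡ (- h)))
  ... | tri≈ _ refl _ = 1ℚ , positive⁻¹ 1ℚ , sym (⊛-identityˡ _)
  ... | tri> _ _ h>0 = s , positive⁻¹ s , cong (λ z → z ∷ V.map (s *_) a , s * b) (sym (*-inverseˡ h))
    where
    instance
      h-pos = positive h>0
      h≢0   = pos⇒nonZero h
      s-pos = 1/pos⇒pos h
    s = 1/ h

  classify-∈-cone : ∀ {n} {Cs : List (Constraint (suc n))} {c} → c ∈ Cs →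
                    Cone Cs (uncurry embed (classify c))
  classify-∈-cone {Cs = Cs} {c} c∈Cs =
    let s , s>0 , eq = classify-positiveMultiple c in
    subst (Cone Cs) (sym eq) (scale s (<⇒≤ s>0) (gen c∈Cs))

  classify-⊨ : ∀ {n} {q : Vec ℚ (suc n)} c → q ⊨ uncurry embed (classify c) → q ⊨ c
  classify-⊨ {q = q} c sat =
    let s , s>0 , eq = classify-positiveMultiple c in
    ⊨-cancel-⊛ c s>0 (subst (q ⊨_) eq sat)

  -- Fourier–Motzkin elimination of the first unknown
  module Elimination {n} (Cs : List (Constraint (suc n))) where

    hasSign : ∀ σ (c : Constraint (suc n)) → Dec (proj₁ (classify c) ≡ σ)
    hasSign σ c = Maybe.≡-dec Sign._≟_ (proj₁ (classify c)) σ

    withSign : Maybe Sign → List (Constraint n)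
    withSign σ = L.map (proj₂ ∘ classify) (L.filter (hasSign σ) Cs)

    ∈-withSign⁻ : ∀ {σ d} → d ∈ withSign σ → Cone Cs (embed σ d)
    ∈-withSign⁻ {σ} d∈ with ∈-map⁻ (proj₂ ∘ classify) d∈
    ... | c , c∈ , refl with ∈-filter⁻ (hasSign σ) {xs = Cs} c∈
    ...   | c∈Cs , refl = classify-∈-cone c∈Cs

    ∈-withSign⁺ : ∀ {c} → c ∈ Cs → proj₂ (classify c) ∈ withSign (proj₁ (classify c))
    ∈-withSign⁺ {c} c∈Cs =
      ∈-map⁺ (proj₂ ∘ classify) (∈-filter⁺ (hasSign (proj₁ (classify c))) c∈Cs refl)

    lowers uppers : List (Constraint n)
    lowers = withSign (just plus)
    uppers = withSign (just minus)

    -- each lower bound paired with each upper bound: 1 + (-1) = 0 removes the unknown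
    eliminated : List (Constraint n)
    eliminated = withSign nothing ++ L.cartesianProductWith _⊕_ lowers uppers

    lift : ∀ {d} → Cone eliminated d → Cone Cs (embed nothing d)
    lift (gen d∈) with ∈-++⁻ (withSign nothing) d∈
    ... | inj₁ d∈free = ∈-withSign⁻ d∈free
    ... | inj₂ d∈pairs with ∈-cartesianProductWith⁻ _⊕_ lowers uppers d∈pairs
    ...   | l , u , l∈ , u∈ , refl = ∈-withSign⁻ l∈ ⊕ᶜ ∈-withSign⁻ u∈
    lift (c ⊕ᶜ d) = lift c ⊕ᶜ lift d
    lift (scale {c = a , b} s s≥0 c) =
      subst (Cone Cs) (cong (λ z → z ∷ V.map (s *_) a , s * b) (*-zeroʳ s)) (scale s s≥0 (lift c))

    -- a lower (upper) constraint d holds at x ∷ q iff x ≥ lowerBound q d (x ≤ upperBound q d)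
    lowerBound upperBound : Vec ℚ n → Constraint n → ℚ
    lowerBound q (a , b) = b - a ∙ q
    upperBound q (a , b) = a ∙ q - b

    extend : ∀ {q} → All (q ⊨_) eliminated → Feasible Cs
    extend {q} sat = x ∷ q , All.tabulate (λ {c} c∈Cs → classify-⊨ c (⊨-embed (∈-withSign⁺ c∈Cs)))
      where
      free-sat = All.++⁻ˡ (withSign nothing) sat
      pair-sat = All.++⁻ʳ (withSign nothing) sat

      compatible : ∀ {l u} → l ∈ lowers → u ∈ uppers → lowerBound q l ≤ upperBound q u
      compatible {al , bl} {au , bu} l∈ u∈ =
        ≤-by-slack (solve 4 (λ bl bu Al Au → Al :+ Au :- (bl :+ bu) := Au :- bu :- (bl :- Al))
                            refl bl bu (al ∙ q) (au ∙ q))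
                   (subst (bl + bu ≤_) (∙-distribʳ-+ al au q)
                          (All.lookup pair-sat (∈-cartesianProductWith⁺ _⊕_ l∈ u∈)))

      bounds = between (L.map (lowerBound q) lowers) (L.map (upperBound q) uppers)
        (All.map⁺ (All.tabulate (λ l∈ → All.map⁺ (All.tabulate (λ u∈ → compatible l∈ u∈)))))
      x = proj₁ bounds
      lowers≤x = All.map⁻ (proj₁ (proj₂ bounds))
      x≤uppers = All.map⁻ (proj₂ (proj₂ bounds))

      ⊨-embed : ∀ {σ d} → d ∈ withSign σ → x ∷ q ⊨ embed σ d
      ⊨-embed {nothing} {a , b} d∈ =
        subst (b ≤_) (sym (trans (cong (_+ a ∙ q) (*-zeroˡ x)) (+-identityˡ (a ∙ q))))
              (All.lookup free-sat d∈)
      ⊨-embed {just plus} {a , b} d∈ =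
        ≤-by-slack (solve 3 (λ x b A → x :- (b :- A) := con 1ℚ :* x :+ A :- b) refl x b (a ∙ q))
                   (All.lookup lowers≤x d∈)
      ⊨-embed {just minus} {a , b} d∈ =
        ≤-by-slack (solve 3 (λ x b A → A :- b :- x := con (- 1ℚ) :* x :+ A :- b) refl x b (a ∙ q))
                   (All.lookup x≤uppers d∈)

  open Elimination using (eliminated; lift; extend)

  farkas : ∀ {n} (Cs : List (Constraint n)) → Feasible Cs ⊎ Refutable Cs
  farkas {zero}  Cs = farkas₀ Cs
  farkas {suc n} Cs with farkas (eliminated Cs)
  ... | inj₁ (q , sat)        = inj₁ (extend Cs sat)
  ... | inj₂ (β , β>0 , cone) = inj₂ (β , β>0 , lift Cs cone)

  -- Sums over the cube

  ∑ : {A : Set} → List A → (A → ℚ) → ℚ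
  ∑ xs f = sumℚ (L.map f xs)

  syntax ∑ xs (λ x → e) = ∑[ x ← xs ] e

  module _ {A : Set} where

    ∑-cong : ∀ (xs : List A) {f g} → (∀ x → f x ≡ g x) → ∑ xs f ≡ ∑ xs g
    ∑-cong xs f≗g = cong sumℚ (L.map-cong f≗g xs)

    ∑-zero : ∀ (xs : List A) {f} → (∀ x → f x ≡ 0ℚ) → ∑ xs f ≡ 0ℚ
    ∑-zero []       f≗0 = refl
    ∑-zero (x ∷ xs) f≗0 rewrite f≗0 x = trans (+-identityˡ _) (∑-zero xs f≗0)

    ∑-distrib-+ : ∀ (xs : List A) f g → ∑[ x ← xs ] (f x + g x) ≡ ∑ xs f + ∑ xs g
    ∑-distrib-+ []       f g = refl
    ∑-distrib-+ (x ∷ xs) f g rewrite ∑-distrib-+ xs f g =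
      solve 4 (λ a b c d → (a :+ b) :+ (c :+ d) := (a :+ c) :+ (b :+ d))
        refl (f x) (g x) (∑ xs f) (∑ xs g)

    *-distribˡ-∑ : ∀ (xs : List A) c f → ∑[ x ← xs ] (c * f x) ≡ c * ∑ xs f
    *-distribˡ-∑ []       c f = sym (*-zeroʳ c)
    *-distribˡ-∑ (x ∷ xs) c f rewrite *-distribˡ-∑ xs c f = sym (*-distribˡ-+ c (f x) _)

    neg-distrib-∑ : ∀ (xs : List A) f → ∑[ x ← xs ] (- f x) ≡ - ∑ xs f
    neg-distrib-∑ []       f = refl
    neg-distrib-∑ (x ∷ xs) f rewrite neg-distrib-∑ xs f = sym (neg-distrib-+ (f x) _)

    ∑-mono-≤ : ∀ (xs : List A) {f g} → (∀ x → f x ≤ g x) → ∑ xs f ≤ ∑ xs g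
    ∑-mono-≤ []       f≤g = ≤-refl
    ∑-mono-≤ (x ∷ xs) f≤g = +-mono-≤ (f≤g x) (∑-mono-≤ xs f≤g)

    ∑-nonNeg : ∀ (xs : List A) {f} → (∀ x → 0ℚ ≤ f x) → 0ℚ ≤ ∑ xs f
    ∑-nonNeg xs {f} 0≤f = subst (_≤ ∑ xs f) (∑-zero xs (λ _ → refl)) (∑-mono-≤ xs 0≤f)

    ∑-++ : ∀ (xs ys : List A) f → ∑ (xs ++ ys) f ≡ ∑ xs f + ∑ ys f
    ∑-++ []       ys f = sym (+-identityˡ _)
    ∑-++ (x ∷ xs) ys f rewrite ∑-++ xs ys f = sym (+-assoc (f x) _ _)

    ∑-map : ∀ {B : Set} (g : B → A) (xs : List B) f → ∑ (L.map g xs) f ≡ ∑ xs (f ∘ g)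
    ∑-map g xs f = cong sumℚ (sym (L.map-∘ xs))

  ∑-comm : ∀ {A B : Set} (xs : List A) (ys : List B) (f : A → B → ℚ) →
           ∑[ a ← xs ] ∑[ b ← ys ] f a b ≡ ∑[ b ← ys ] ∑[ a ← xs ] f a b
  ∑-comm []       ys f = sym (∑-zero ys (λ _ → refl))
  ∑-comm (x ∷ xs) ys f rewrite ∑-comm xs ys f =
    sym (∑-distrib-+ ys (f x) (λ b → ∑[ a ← xs ] f a b))

  module Cube {A : Set} (_≟_ : DecidableEquality A) {u w : A} (u≢w : u ≢ w)
              (u-or-w : ∀ a → a ≡ u ⊎ a ≡ w) where

    cube : ∀ k → List (Vec A k)
    cube = allVecs (u ∷ w ∷ [])

    ∑-cube-suc : ∀ k (f : Vec A (suc k) → ℚ) →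
                 ∑ (cube (suc k)) f ≡ ∑ (cube k) (f ∘ (u ∷_)) + ∑ (cube k) (f ∘ (w ∷_))
    ∑-cube-suc k f = begin
      ∑ (L.map (u ∷_) X ++ (L.map (w ∷_) X ++ [])) f
        ≡⟨ ∑-++ (L.map (u ∷_) X) _ f ⟩
      ∑ (L.map (u ∷_) X) f + ∑ (L.map (w ∷_) X ++ []) f
        ≡⟨ cong (∑ (L.map (u ∷_) X) f +_) (trans (∑-++ (L.map (w ∷_) X) [] f) (+-identityʳ _)) ⟩
      ∑ (L.map (u ∷_) X) f + ∑ (L.map (w ∷_) X) f
        ≡⟨ cong₂ _+_ (∑-map (u ∷_) X f) (∑-map (w ∷_) X f) ⟩
      ∑ X (f ∘ (u ∷_)) + ∑ X (f ∘ (w ∷_))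
        ∎
      where
      open ≡-Reasoning
      X = cube k

    ∈-cube : ∀ {k} (v : Vec A k) → v ∈ cube k
    ∈-cube []              = here refl
    ∈-cube {suc k} (a ∷ v) with u-or-w a
    ... | inj₁ refl = ∈-++⁺ˡ (∈-map⁺ (a ∷_) (∈-cube v))
    ... | inj₂ refl = ∈-++⁺ʳ (L.map (u ∷_) (cube k)) (∈-++⁺ˡ (∈-map⁺ (a ∷_) (∈-cube v)))

    ∑-pointMass : ∀ {k} (z : Vec A k) (f : Vec A k → ℚ) → (∀ v → v ≢ z → f v ≡ 0ℚ) →
                  ∑ (cube k) f ≡ f z
    ∑-pointMass []              f _     = +-identityʳ (f [])
    ∑-pointMass {suc k} (a ∷ z) f off-z = trans (∑-cube-suc k f) (halves (u-or-w a))
      where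
      through-z : ∀ {b} → b ≡ a → ∑ (cube k) (f ∘ (b ∷_)) ≡ f (a ∷ z)
      through-z refl = ∑-pointMass z (f ∘ (a ∷_)) (λ v v≢z → off-z _ (v≢z ∘ V.∷-injectiveʳ))

      off : ∀ {b} → b ≢ a → ∑ (cube k) (f ∘ (b ∷_)) ≡ 0ℚ
      off b≢a = ∑-zero (cube k) (λ v → off-z _ (b≢a ∘ V.∷-injectiveˡ))

      halves : a ≡ u ⊎ a ≡ w → ∑ (cube k) (f ∘ (u ∷_)) + ∑ (cube k) (f ∘ (w ∷_)) ≡ f (a ∷ z)
      halves (inj₁ a≡u) =
        trans (cong₂ _+_ (through-z (sym a≡u)) (off (λ w≡a → u≢w (trans (sym a≡u) (sym w≡a)))))
              (+-identityʳ _)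
      halves (inj₂ a≡w) =
        trans (cong₂ _+_ (off (λ u≡a → u≢w (trans u≡a a≡w))) (through-z (sym a≡w)))
              (+-identityˡ _)

    ∑-indicator : ∀ {k} (z : Vec A k) c (g : Vec A k → ℚ) →
      ∑[ v ← cube k ] ((if does (V.≡-dec _≟_ v z) then c else 0ℚ) * g v) ≡ c * g z
    ∑-indicator z c g =
      trans (∑-pointMass z _ off-z)
            (cong (λ b → (if b then c else 0ℚ) * g z) (dec-true (V.≡-dec _≟_ z z) refl))
      where
      off-z : ∀ v → v ≢ z → (if does (V.≡-dec _≟_ v z) then c else 0ℚ) * g v ≡ 0ℚ
      off-z v v≢z =
        trans (cong (λ b → (if b then c else 0ℚ) * g v) (dec-false (V.≡-dec _≟_ v z) v≢z)) (*-zeroˡ (g v))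

  minus≢plus : minus ≢ plus
  minus≢plus ()

  minus-or-plus : ∀ s → s ≡ minus ⊎ s ≡ plus
  minus-or-plus minus = inj₁ refl
  minus-or-plus plus  = inj₂ refl

  outside≢inside : outside ≢ inside
  outside≢inside ()

  outside-or-inside : ∀ b → b ≡ outside ⊎ b ≡ inside
  outside-or-inside false = inj₁ refl
  outside-or-inside true  = inj₂ refl

  module Points  = Cube Sign._≟_ minus≢plus minus-or-plus
  module Subsets = Cube Bool._≟_ outside≢inside outside-or-inside

  _≟ᵖ_ : ∀ {k} → DecidableEquality (Point k)
  _≟ᵖ_ = V.≡-dec Sign._≟_

  _≟ˢ_ : ∀ {k} → DecidableEquality (Subset k)
  _≟ˢ_ = V.≡-dec Bool._≟_

  Σpts-suc : ∀ k (f : Point (suc k) → ℚ) →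
             Σpts (suc k) f ≡ Σpts k (f ∘ (minus ∷_)) + Σpts k (f ∘ (plus ∷_))
  Σpts-suc = Points.∑-cube-suc

  -- Moments and marginals

  marginal : ∀ {k} → (Point (suc k) → ℚ) → Point k → ℚ
  marginal y x = y (minus ∷ x) + y (plus ∷ x)

  Σpts-marginal : ∀ {k} (y : Point (suc k) → ℚ) → Σpts (suc k) y ≡ Σpts k (marginal y)
  Σpts-marginal {k} y = trans (Σpts-suc k y) (sym (∑-distrib-+ (allPoints k) _ _))

  mass : ∀ {k} → (Point k → ℚ) → (Point k → Bool) → ℚ
  mass {k} y E = Σpts k (λ x → if E x then y x else 0ℚ)

  moment : ∀ {k} → (Point k → ℚ) → Subset k → ℚ
  moment {k} y T = Σpts k (λ x → y x * monomial T x)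

  if-+ : ∀ b {p q} → (if b then p else 0ℚ) + (if b then q else 0ℚ) ≡ (if b then p + q else 0ℚ)
  if-+ true  = refl
  if-+ false = refl

  if-nonNeg : ∀ b {u} → 0ℚ ≤ u → 0ℚ ≤ (if b then u else 0ℚ)
  if-nonNeg true  0≤u = 0≤u
  if-nonNeg false _   = ≤-refl

  mass-outside : ∀ {k} (y : Point (suc k) → ℚ) S s a →
                 mass y (agreeOn (outside ∷ S) (s ∷ a)) ≡ mass (marginal y) (agreeOn S a)
  mass-outside {k} y S s a =
    trans (Σpts-marginal (λ x → if agreeOn (outside ∷ S) (s ∷ a) x then y x else 0ℚ))
          (∑-cong (allPoints k) (λ x → if-+ (agreeOn S a x)))

  mass-inside : ∀ {k} (y : Point (suc k) → ℚ) S s a →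
                mass y (agreeOn (inside ∷ S) (s ∷ a)) ≡ mass (y ∘ (s ∷_)) (agreeOn S a)
  mass-inside {k} y S minus a =
    trans (Σpts-suc k (λ x → if agreeOn (inside ∷ S) (minus ∷ a) x then y x else 0ℚ))
          (trans (cong (mass (y ∘ (minus ∷_)) (agreeOn S a) +_) (∑-zero (allPoints k) (λ _ → refl)))
                 (+-identityʳ _))
  mass-inside {k} y S plus a =
    trans (Σpts-suc k (λ x → if agreeOn (inside ∷ S) (plus ∷ a) x then y x else 0ℚ))
          (trans (cong (_+ mass (y ∘ (plus ∷_)) (agreeOn S a)) (∑-zero (allPoints k) (λ _ → refl)))
                 (+-identityˡ _))

  moment-outside : ∀ {k} (y : Point (suc k) → ℚ) T → moment y (outside ∷ T) ≡ moment (marginal y) T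
  moment-outside {k} y T =
    trans (Σpts-marginal (λ x → y x * monomial (outside ∷ T) x))
          (∑-cong (allPoints k) (λ x → sym (*-distribʳ-+ (monomial T x) (y (minus ∷ x)) (y (plus ∷ x)))))

  moment-inside : ∀ {k} (y : Point (suc k) → ℚ) T →
                  moment y (inside ∷ T) ≡ moment (y ∘ (plus ∷_)) T - moment (y ∘ (minus ∷_)) T
  moment-inside {k} y T = begin
    moment y (inside ∷ T)
      ≡⟨ Σpts-suc k (λ x → y x * monomial (inside ∷ T) x) ⟩
    Σpts k (λ x → y (minus ∷ x) * (- 1ℚ * monomial T x))
      + Σpts k (λ x → y (plus ∷ x) * (1ℚ * monomial T x))
      ≡⟨ cong₂ _+_ (trans (∑-cong (allPoints k) (λ x → neg-inside (y (minus ∷ x)) (monomial T x)))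
                          (neg-distrib-∑ (allPoints k) _))
                   (∑-cong (allPoints k) (λ x → cong (y (plus ∷ x) *_) (*-identityˡ (monomial T x)))) ⟩
    - moment (y ∘ (minus ∷_)) T + moment (y ∘ (plus ∷_)) T
      ≡⟨ +-comm (- moment (y ∘ (minus ∷_)) T) _ ⟩
    moment (y ∘ (plus ∷_)) T - moment (y ∘ (minus ∷_)) T
      ∎
    where
    open ≡-Reasoning
    neg-inside : ∀ p m → p * (- 1ℚ * m) ≡ - (p * m)
    neg-inside = solve 2 (λ p m → p :* (con (- 1ℚ) :* m) := :- (p :* m)) refl

  monomial-⊥ : ∀ {k} (x : Point k) → monomial ⊥ x ≡ 1ℚ
  monomial-⊥ []      = refl
  monomial-⊥ (_ ∷ x) = monomial-⊥ x

  moment-⊥ : ∀ {k} (y : Point k → ℚ) → moment y ⊥ ≡ Σpts k y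
  moment-⊥ {k} y = ∑-cong (allPoints k) (λ x → trans (cong (y x *_) (monomial-⊥ x)) (*-identityʳ (y x)))

  ½-sum-diff : ∀ a b → b - a ≡ 0ℚ → a ≡ ½ * (a + b) × b ≡ ½ * (a + b)
  ½-sum-diff a b b-a≡0 =
    trans (solve 2 (λ a b → a := con ½ :* (a :+ b) :- con ½ :* (b :- a)) refl a b)
          (trans (cong (λ d → ½ * (a + b) - ½ * d) b-a≡0) (+-identityʳ _)) ,
    trans (solve 2 (λ a b → b := con ½ :* (a :+ b) :+ con ½ :* (b :- a)) refl a b)
          (trans (cong (λ d → ½ * (a + b) + ½ * d) b-a≡0) (+-identityʳ _))

  MomentsVanishUpTo : ∀ {k} → ℕ → (Point k → ℚ) → Set
  MomentsVanishUpTo t y = ∀ T → 1 ℕ.≤ ∣ T ∣ → ∣ T ∣ ℕ.≤ t → moment y T ≡ 0ℚ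

  -- the moments of y at outside ∷ T and inside ∷ T are the sum and the difference of
  -- the moments of its two halves at T
  halves-momentsVanish : ∀ {k t} {y : Point (suc k) → ℚ} → MomentsVanishUpTo (suc t) y →
                         ∀ s → MomentsVanishUpTo t (y ∘ (s ∷_))
  halves-momentsVanish {k} {y = y} vanish s T 1≤∣T∣ ∣T∣≤t = half s
    where
    a = moment (y ∘ (minus ∷_)) T
    b = moment (y ∘ (plus ∷_)) T
    a+b≡0 : a + b ≡ 0ℚ
    a+b≡0 = trans (sym (Σpts-suc k (λ x → y x * monomial (outside ∷ T) x)))
                  (vanish (outside ∷ T) 1≤∣T∣ (ℕ.m≤n⇒m≤1+n ∣T∣≤t))
    halves = ½-sum-diff a b
      (trans (sym (moment-inside y T)) (vanish (inside ∷ T) (s≤s z≤n) (s≤s ∣T∣≤t)))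
    half : ∀ s → moment (y ∘ (s ∷_)) T ≡ 0ℚ
    half minus = trans (proj₁ halves) (cong (½ *_) a+b≡0)
    half plus  = trans (proj₂ halves) (cong (½ *_) a+b≡0)

  half-total : ∀ {k} (y : Point (suc k) → ℚ) → moment y (inside ∷ ⊥) ≡ 0ℚ →
               ∀ s → Σpts k (y ∘ (s ∷_)) ≡ ½ * Σpts (suc k) y
  half-total {k} y first-moment≡0 s = trans (half s) (cong (½ *_) (sym (Σpts-suc k y)))
    where
    halves = ½-sum-diff (Σpts k (y ∘ (minus ∷_))) (Σpts k (y ∘ (plus ∷_)))
      (trans (sym (trans (moment-inside y ⊥)
                         (cong₂ _-_ (moment-⊥ (y ∘ (plus ∷_))) (moment-⊥ (y ∘ (minus ∷_))))))
             first-moment≡0)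
    half : ∀ s → Σpts k (y ∘ (s ∷_)) ≡ ½ * (Σpts k (y ∘ (minus ∷_)) + Σpts k (y ∘ (plus ∷_)))
    half minus = proj₁ halves
    half plus  = proj₂ halves

  momentsVanish⇒uniform : ∀ {k t} {y : Point k → ℚ} → MomentsVanishUpTo t y →
                          ∀ S → ∣ S ∣ ℕ.≤ t → ∀ a → mass y (agreeOn S a) ≡ ½^ ∣ S ∣ * Σpts k y
  momentsVanish⇒uniform {zero} {y = y} _ [] _ [] = sym (*-identityˡ (y [] + 0ℚ))
  momentsVanish⇒uniform {suc k} {y = y} vanish (outside ∷ S) ∣S∣≤t (s ∷ a) = begin
    mass y (agreeOn (outside ∷ S) (s ∷ a))  ≡⟨ mass-outside y S s a ⟩
    mass (marginal y) (agreeOn S a)         ≡⟨ momentsVanish⇒uniform marginal-vanish S ∣S∣≤t a ⟩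
    ½^ ∣ S ∣ * Σpts k (marginal y)          ≡⟨ cong (½^ ∣ S ∣ *_) (sym (Σpts-marginal y)) ⟩
    ½^ ∣ S ∣ * Σpts (suc k) y               ∎
    where
    open ≡-Reasoning
    marginal-vanish : MomentsVanishUpTo _ (marginal y)
    marginal-vanish T 1≤∣T∣ ∣T∣≤t =
      trans (sym (moment-outside y T)) (vanish (outside ∷ T) 1≤∣T∣ ∣T∣≤t)
  momentsVanish⇒uniform {suc k} {zero}  _ (inside ∷ S) () _
  momentsVanish⇒uniform {suc k} {suc t} {y} vanish (inside ∷ S) (s≤s ∣S∣≤t) (s ∷ a) = begin
    mass y (agreeOn (inside ∷ S) (s ∷ a))
      ≡⟨ mass-inside y S s a ⟩
    mass (y ∘ (s ∷_)) (agreeOn S a)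
      ≡⟨ momentsVanish⇒uniform (halves-momentsVanish {y = y} vanish s) S ∣S∣≤t a ⟩
    ½^ ∣ S ∣ * Σpts k (y ∘ (s ∷_))
      ≡⟨ cong (½^ ∣ S ∣ *_) (half-total y first-moment≡0 s) ⟩
    ½^ ∣ S ∣ * (½ * Σpts (suc k) y)
      ≡⟨ solve 2 (λ h σ → h :* (con ½ :* σ) := con ½ :* h :* σ) refl (½^ ∣ S ∣) _ ⟩
    ½ * ½^ ∣ S ∣ * Σpts (suc k) y
      ∎
    where
    open ≡-Reasoning
    first-moment≡0 = vanish (inside ∷ ⊥) (s≤s z≤n) (s≤s (subst (ℕ._≤ t) (sym (∣⊥∣≡0 k)) z≤n))

  SameMarginals : ∀ {k} → Subset k → (Point k → ℚ) → (Point k → ℚ) → Set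
  SameMarginals S y y′ = ∀ a → mass y (agreeOn S a) ≡ mass y′ (agreeOn S a)

  SameMarginals-outside : ∀ {k} {S : Subset k} {y y′} → SameMarginals (outside ∷ S) y y′ →
                          SameMarginals S (marginal y) (marginal y′)
  SameMarginals-outside {S = S} {y} {y′} same a =
    trans (sym (mass-outside y S minus a)) (trans (same (minus ∷ a)) (mass-outside y′ S minus a))

  SameMarginals-inside : ∀ {k} {S : Subset k} {y y′} → SameMarginals (inside ∷ S) y y′ →
                         ∀ s → SameMarginals S (y ∘ (s ∷_)) (y′ ∘ (s ∷_))
  SameMarginals-inside {S = S} {y} {y′} same s a =
    trans (sym (mass-inside y S s a)) (trans (same (s ∷ a)) (mass-inside y′ S s a))

  UniformOn : ∀ {k} → Subset k → ℚ → (Point k → ℚ) → Set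
  UniformOn S c y = ∀ a → mass y (agreeOn S a) ≡ c

  UniformOn-outside : ∀ {k} {S : Subset k} {c y} → UniformOn (outside ∷ S) c y →
                      UniformOn S c (marginal y)
  UniformOn-outside {S = S} {y = y} uniform a = trans (sym (mass-outside y S minus a)) (uniform (minus ∷ a))

  UniformOn-inside : ∀ {k} {S : Subset k} {c y} → UniformOn (inside ∷ S) c y →
                     ∀ s → UniformOn S c (y ∘ (s ∷_))
  UniformOn-inside {S = S} {y = y} uniform s a = trans (sym (mass-inside y S s a)) (uniform (s ∷ a))

  inside⊈outside : ∀ {k} {T S : Subset k} → ¬ (inside ∷ T ⊆ outside ∷ S)
  inside⊈outside T⊆S with T⊆S V.here
  ... | ()

  moment-determinedBy-marginals : ∀ {k} {S T : Subset k} {y y′ : Point k → ℚ} →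
                                  T ⊆ S → SameMarginals S y y′ → moment y T ≡ moment y′ T
  moment-determinedBy-marginals {zero} {[]} {[]} {y} {y′} _ same =
    trans (cong (_+ 0ℚ) (*-identityʳ (y []))) (trans (same []) (cong (_+ 0ℚ) (sym (*-identityʳ (y′ [])))))
  moment-determinedBy-marginals {suc k} {outside ∷ S} {outside ∷ T} {y} {y′} T⊆S same = begin
    moment y (outside ∷ T)    ≡⟨ moment-outside y T ⟩
    moment (marginal y) T     ≡⟨ moment-determinedBy-marginals (drop-∷-⊆ T⊆S) (SameMarginals-outside same) ⟩
    moment (marginal y′) T    ≡⟨ sym (moment-outside y′ T) ⟩
    moment y′ (outside ∷ T)   ∎
    where open ≡-Reasoning
  moment-determinedBy-marginals {suc k} {inside ∷ S} {outside ∷ T} {y} {y′} T⊆S same =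
    trans (Σpts-suc k (λ x → y x * monomial (outside ∷ T) x))
          (trans (cong₂ _+_ (halves minus) (halves plus))
                 (sym (Σpts-suc k (λ x → y′ x * monomial (outside ∷ T) x))))
    where
    halves : ∀ s → moment (y ∘ (s ∷_)) T ≡ moment (y′ ∘ (s ∷_)) T
    halves s = moment-determinedBy-marginals (drop-∷-⊆ T⊆S) (SameMarginals-inside same s)
  moment-determinedBy-marginals {suc k} {inside ∷ S} {inside ∷ T} {y} {y′} T⊆S same =
    trans (moment-inside y T) (trans (cong₂ _-_ (halves plus) (halves minus)) (sym (moment-inside y′ T)))
    where
    halves : ∀ s → moment (y ∘ (s ∷_)) T ≡ moment (y′ ∘ (s ∷_)) T
    halves s = moment-determinedBy-marginals (drop-∷-⊆ T⊆S) (SameMarginals-inside same s)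
  moment-determinedBy-marginals {suc k} {outside ∷ S} {inside ∷ T} T⊆S _ = ⊥-elim (inside⊈outside T⊆S)

  uniform⇒moment-vanishes : ∀ {k} {S T : Subset k} {c} {y : Point k → ℚ} →
                            UniformOn S c y → T ⊆ S → 1 ℕ.≤ ∣ T ∣ → moment y T ≡ 0ℚ
  uniform⇒moment-vanishes {zero} {[]} {[]} _ _ ()
  uniform⇒moment-vanishes {suc k} {outside ∷ S} {outside ∷ T} {y = y} uniform T⊆S 1≤∣T∣ =
    trans (moment-outside y T) (uniform⇒moment-vanishes (UniformOn-outside uniform) (drop-∷-⊆ T⊆S) 1≤∣T∣)
  uniform⇒moment-vanishes {suc k} {inside ∷ S} {outside ∷ T} {y = y} uniform T⊆S 1≤∣T∣ =
    trans (Σpts-suc k (λ x → y x * monomial (outside ∷ T) x))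
          (cong₂ _+_ (uniform⇒moment-vanishes (UniformOn-inside uniform minus) (drop-∷-⊆ T⊆S) 1≤∣T∣)
                     (uniform⇒moment-vanishes (UniformOn-inside uniform plus) (drop-∷-⊆ T⊆S) 1≤∣T∣))
  -- the two halves have the same S-marginals, hence the same moments
  uniform⇒moment-vanishes {suc k} {inside ∷ S} {inside ∷ T} {y = y} uniform T⊆S _ =
    trans (moment-inside y T)
          (trans (cong (_- moment (y ∘ (minus ∷_)) T)
                       (moment-determinedBy-marginals (drop-∷-⊆ T⊆S) same-halves))
                 (+-inverseʳ (moment (y ∘ (minus ∷_)) T)))
    where
    same-halves : SameMarginals S (y ∘ (plus ∷_)) (y ∘ (minus ∷_))
    same-halves a = trans (UniformOn-inside uniform plus a) (sym (UniformOn-inside uniform minus a))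
  uniform⇒moment-vanishes {suc k} {outside ∷ S} {inside ∷ T} _ T⊆S _ = ⊥-elim (inside⊈outside T⊆S)

  ⊆-superset : ∀ {k t} (T : Subset k) → ∣ T ∣ ℕ.≤ t → t ℕ.≤ k →
               ∃ λ S → T ⊆ S × ∣ S ∣ ≡ t
  ⊆-superset [] z≤n z≤n = [] , ⊆-refl , refl
  ⊆-superset {suc k} {suc t} (inside ∷ T) (s≤s ∣T∣≤t) (s≤s t≤k) =
    let S , T⊆S , ∣S∣≡t = ⊆-superset T ∣T∣≤t t≤k in
    inside ∷ S , in⊆in T⊆S , cong suc ∣S∣≡t
  ⊆-superset {suc k} {t} (outside ∷ T) ∣T∣≤t t≤1+k with t ℕ.≤? k
  ... | yes t≤k =
    let S , T⊆S , ∣S∣≡t = ⊆-superset T ∣T∣≤t t≤k in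
    outside ∷ S , out⊆ T⊆S , ∣S∣≡t
  ... | no  t≰k = ⊤ , ⊆⊤ , trans (∣⊤∣≡n (suc k)) (ℕ.≤-antisym (ℕ.≰⇒> t≰k) t≤1+k)

  twiseUniform⇒momentsVanish : ∀ {k t} {D : Distribution k} → t ℕ.≤ k → TWiseUniform t D →
                               MomentsVanishUpTo t (prob D)
  twiseUniform⇒momentsVanish t≤k uniform T 1≤∣T∣ ∣T∣≤t =
    let S , T⊆S , ∣S∣≡t = ⊆-superset T ∣T∣≤t t≤k in
    uniform⇒moment-vanishes (uniform S ∣S∣≡t) T⊆S 1≤∣T∣

  module Normalise {k} (y : Point k → ℚ) (y≥0 : ∀ x → 0ℚ ≤ y x) (total>0 : 0ℚ < Σpts k y) where
    private
      total = Σpts k y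
      instance
        total-pos = positive total>0
        total≢0   = pos⇒nonZero total

      1/total-cancel : ∀ p → 1/ total * (p * total) ≡ p
      1/total-cancel p = trans (solve 3 (λ i p s → i :* (p :* s) := p :* (i :* s)) refl (1/ total) p total)
                               (trans (cong (p *_) (*-inverseˡ total)) (*-identityʳ p))

    distribution : Distribution k
    distribution = record
      { prob    = λ x → 1/ total * y x
      ; nonneg  = λ x → *-nonNeg (<⇒≤ (positive⁻¹ (1/ total) {{1/pos⇒pos total}})) (y≥0 x)
      ; sum-one = trans (*-distribˡ-∑ (allPoints k) (1/ total) y) (*-inverseˡ total)
      }

    private
      Pr≡1/total*mass : ∀ E → Pr distribution E ≡ 1/ total * mass y E
      Pr≡1/total*mass E =
        trans (∑-cong (allPoints k) (λ x → if-* (E x) (y x))) (*-distribˡ-∑ (allPoints k) (1/ total) _)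
        where
        if-* : ∀ b u → (if b then 1/ total * u else 0ℚ) ≡ 1/ total * (if b then u else 0ℚ)
        if-* true  u = refl
        if-* false u = sym (*-zeroʳ (1/ total))

    Pr-distribution : ∀ E → Pr distribution E * Σpts k y ≡ mass y E
    Pr-distribution E = trans (cong (_* total) (Pr≡1/total*mass E))
                              (trans (*-assoc (1/ total) (mass y E) total) (1/total-cancel (mass y E)))

    momentsVanish⇒twiseUniform : ∀ {t} → MomentsVanishUpTo t y → TWiseUniform t distribution
    momentsVanish⇒twiseUniform {t} vanish S ∣S∣≡t a = begin
      Pr distribution (agreeOn S a)    ≡⟨ Pr≡1/total*mass (agreeOn S a) ⟩
      1/ total * mass y (agreeOn S a)
        ≡⟨ cong (1/ total *_) (momentsVanish⇒uniform vanish S (ℕ.≤-reflexive ∣S∣≡t) a) ⟩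
      1/ total * (½^ ∣ S ∣ * total)    ≡⟨ 1/total-cancel (½^ ∣ S ∣) ⟩
      ½^ ∣ S ∣                         ≡⟨ cong ½^ ∣S∣≡t ⟩
      ½^ t                             ∎
      where open ≡-Reasoning

  -- The linear program of separating polynomials

  threshold : ∀ {k} → Predicate k → ℚ → Point k → ℚ
  threshold P δ z = if P z then δ else δ - 1ℚ

  Σpts-threshold : ∀ {k} (P : Predicate k) δ (y : Point k → ℚ) →
                   Σpts k (λ x → y x * threshold P δ x) ≡ δ * Σpts k y - mass y (λ x → not? (P x))
  Σpts-threshold {k} P δ y = begin
    Σpts k (λ x → y x * threshold P δ x)
      ≡⟨ ∑-cong (allPoints k) (λ x → pointwise (P x) (y x)) ⟩
    Σpts k (λ x → δ * y x + - (if not? (P x) then y x else 0ℚ))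
      ≡⟨ ∑-distrib-+ (allPoints k) (λ x → δ * y x) _ ⟩
    Σpts k (λ x → δ * y x) + Σpts k (λ x → - (if not? (P x) then y x else 0ℚ))
      ≡⟨ cong₂ _+_ (*-distribˡ-∑ (allPoints k) δ y)
                   (neg-distrib-∑ (allPoints k) (λ x → if not? (P x) then y x else 0ℚ)) ⟩
    δ * Σpts k y - mass y (λ x → not? (P x))
      ∎
    where
    open ≡-Reasoning
    pointwise : ∀ b u → u * (if b then δ else δ - 1ℚ) ≡ δ * u + - (if not? b then u else 0ℚ)
    pointwise true  u = solve 2 (λ u δ → u :* δ := δ :* u :+ :- con 0ℚ) refl u δ
    pointwise false u = solve 2 (λ u δ → u :* (δ :- con 1ℚ) := δ :* u :+ :- u) refl u δ

  separating⇒threshold≤eval : ∀ {k} {P : Predicate k} {δ Q} → Separating P δ Q →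
                              ∀ z → threshold P δ z ≤ eval Q z
  separating⇒threshold≤eval {P = P} (lower , on-P , _) z with P z in Pz
  ... | true  = on-P z Pz
  ... | false = lower z

  threshold≤eval⇒separating : ∀ {k} {P : Predicate k} {δ Q} → (∀ z → threshold P δ z ≤ eval Q z) →
                              Q ⊥ ≡ 0ℚ → Separating P δ Q
  threshold≤eval⇒separating {P = P} {δ} {Q} bound Q⊥≡0 = lower , on-P , Q⊥≡0
    where
    δ-1≤δ : δ - 1ℚ ≤ δ
    δ-1≤δ = ≤-by-slack (solve 1 (λ δ → con 1ℚ :- con 0ℚ := δ :- (δ :- con 1ℚ)) refl δ)
                       (<⇒≤ (positive⁻¹ 1ℚ))
    lower : ∀ z → δ - 1ℚ ≤ eval Q z
    lower z with P z | bound z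
    ... | true  | δ≤Qz   = ≤-trans δ-1≤δ δ≤Qz
    ... | false | δ-1≤Qz = δ-1≤Qz
    on-P : ∀ z → P z ≡ true → δ ≤ eval Q z
    on-P z Pz = subst (λ b → (if b then δ else δ - 1ℚ) ≤ eval Q z) Pz (bound z)

  expectation-eval : ∀ {k} (y : Point k → ℚ) (Q : MultilinearPoly k) →
                     Σpts k (λ x → y x * eval Q x) ≡ ∑[ T ← allSubsets k ] (Q T * moment y T)
  expectation-eval {k} y Q = begin
    Σpts k (λ x → y x * eval Q x)
      ≡⟨ ∑-cong (allPoints k) (λ x → sym (*-distribˡ-∑ (allSubsets k) (y x) (λ T → Q T * monomial T x))) ⟩
    ∑[ x ← allPoints k ] ∑[ T ← allSubsets k ] (y x * (Q T * monomial T x))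
      ≡⟨ ∑-comm (allPoints k) (allSubsets k) (λ x T → y x * (Q T * monomial T x)) ⟩
    ∑[ T ← allSubsets k ] ∑[ x ← allPoints k ] (y x * (Q T * monomial T x))
      ≡⟨ ∑-cong (allSubsets k) (λ T →
           trans (∑-cong (allPoints k) (λ x → rearrange (y x) (Q T) (monomial T x)))
                 (*-distribˡ-∑ (allPoints k) (Q T) (λ x → y x * monomial T x))) ⟩
    ∑[ T ← allSubsets k ] (Q T * moment y T)
      ∎
    where
    open ≡-Reasoning
    rearrange : ∀ a b c → a * (b * c) ≡ b * (a * c)
    rearrange = solve 3 (λ a b c → a :* (b :* c) := b :* (a :* c)) refl

  ⊥⊎nonempty : ∀ {k} (T : Subset k) → T ≡ ⊥ ⊎ 1 ℕ.≤ ∣ T ∣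
  ⊥⊎nonempty []            = inj₁ refl
  ⊥⊎nonempty (inside ∷ T)  = inj₂ (s≤s z≤n)
  ⊥⊎nonempty (outside ∷ T) with ⊥⊎nonempty T
  ... | inj₁ refl   = inj₁ refl
  ... | inj₂ 1≤∣T∣ = inj₂ 1≤∣T∣

  expectation-vanishes : ∀ {k t} {y : Point k → ℚ} {Q} → MomentsVanishUpTo t y → DegreeAtMost t Q →
                         Q ⊥ ≡ 0ℚ → Σpts k (λ x → y x * eval Q x) ≡ 0ℚ
  expectation-vanishes {k} {t} {y} {Q} vanish deg Q⊥≡0 =
    trans (expectation-eval y Q) (∑-zero (allSubsets k) term≡0)
    where
    term≡0 : ∀ T → Q T * moment y T ≡ 0ℚ
    term≡0 T with ⊥⊎nonempty T
    ... | inj₁ refl = trans (cong (_* moment y ⊥) Q⊥≡0) (*-zeroˡ (moment y ⊥))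
    ... | inj₂ 1≤∣T∣ with ∣ T ∣ ℕ.≤? t
    ...   | yes ∣T∣≤t = trans (cong (Q T *_) (vanish T 1≤∣T∣ ∣T∣≤t)) (*-zeroʳ (Q T))
    ...   | no  ∣T∣≰t = trans (cong (_* moment y T) (deg T (ℕ.≰⇒> ∣T∣≰t))) (*-zeroˡ (moment y T))

  separating⇒far : ∀ {k t} {P : Predicate k} {δ Q} → t ℕ.≤ k → Separating P δ Q → DegreeAtMost t Q →
                   DeltaFar P t δ
  separating⇒far {k} {t} {P} {δ} {Q} t≤k separating deg D uniform =
    ≤-by-slack (solve 2 (λ δ r → con 0ℚ :- (δ :* con 1ℚ :- r) := r :- δ) refl δ (Pr D (λ x → not? (P x))))
               expectation≤0
    where
    open ≤-Reasoning
    p = prob D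
    expectation≤0 : δ * 1ℚ - Pr D (λ x → not? (P x)) ≤ 0ℚ
    expectation≤0 = begin
      δ * 1ℚ - Pr D (λ x → not? (P x))
        ≡⟨ cong (λ s → δ * s - Pr D (λ x → not? (P x))) (sym (sum-one D)) ⟩
      δ * Σpts k p - mass p (λ x → not? (P x))
        ≡⟨ sym (Σpts-threshold P δ p) ⟩
      Σpts k (λ x → p x * threshold P δ x)
        ≤⟨ ∑-mono-≤ (allPoints k) (λ x → *-monoˡ-≤-nonNeg (p x) {{nonNegative (nonneg D x)}}
                                            (separating⇒threshold≤eval {Q = Q} separating x)) ⟩
      Σpts k (λ x → p x * eval Q x)
        ≡⟨ expectation-vanishes {y = p} {Q} (twiseUniform⇒momentsVanish {D = D} t≤k uniform) deg
                                (proj₂ (proj₂ separating)) ⟩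
      0ℚ
        ∎

  weights⇒¬far : ∀ {k t} {P : Predicate k} {δ} (y : Point k → ℚ) → (∀ x → 0ℚ ≤ y x) →
                 MomentsVanishUpTo t y → 0ℚ < Σpts k (λ x → y x * threshold P δ x) → ¬ DeltaFar P t δ
  weights⇒¬far {k} {t} {P} {δ} y y≥0 vanish expected>0 far =
    <-irrefl refl (<-≤-trans expected>0 expected≤0)
    where
    total = Σpts k y
    N = mass y (λ x → not? (P x))
    expected = Σpts k (λ x → y x * threshold P δ x)

    expected≡ : expected ≡ δ * total - N
    expected≡ = Σpts-threshold P δ y

    expected≤δ*total : expected ≤ δ * total
    expected≤δ*total = subst (_≤ δ * total) (sym expected≡)
      (≤-by-slack (solve 2 (λ a n → n :- con 0ℚ := a :- (a :- n)) refl (δ * total) N)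
                  (∑-nonNeg (allPoints k) (λ x → if-nonNeg (not? (P x)) (y≥0 x))))

    total>0 : 0ℚ < total
    total>0 with <-cmp 0ℚ total
    ... | tri< 0<total _ _ = 0<total
    ... | tri≈ _ 0≡total _ =
      ⊥-elim (<-irrefl (trans (sym (*-zeroʳ δ)) (cong (δ *_) 0≡total))
                       (<-≤-trans expected>0 expected≤δ*total))
    ... | tri> _ _ total<0 = ⊥-elim (<-irrefl refl (<-≤-trans total<0 (∑-nonNeg (allPoints k) y≥0)))

    open Normalise y y≥0 total>0

    δ*total≤N : δ * total ≤ N
    δ*total≤N = subst (δ * total ≤_) (Pr-distribution (λ x → not? (P x)))
      (*-monoʳ-≤-nonNeg total {{nonNegative (<⇒≤ total>0)}}
                        (far distribution (momentsVanish⇒twiseUniform vanish)))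

    expected≤0 : expected ≤ 0ℚ
    expected≤0 = subst (_≤ 0ℚ) (sym expected≡)
      (≤-by-slack (solve 2 (λ a n → n :- a := con 0ℚ :- (a :- n)) refl (δ * total) N) δ*total≤N)

  module _ {k : ℕ} where

    monomials : (Ts : List (Subset k)) → Point k → Vec ℚ (L.length Ts)
    monomials []       z = []
    monomials (T ∷ Ts) z = monomial T z ∷ monomials Ts z

    lookup-monomials : ∀ {T Ts} (T∈Ts : T ∈ Ts) z → V.lookup (monomials Ts z) (index T∈Ts) ≡ monomial T z
    lookup-monomials (here refl)  z = refl
    lookup-monomials (there T∈Ts) z = lookup-monomials T∈Ts z

    fromCoefficients : (Ts : List (Subset k)) → Vec ℚ (L.length Ts) → MultilinearPoly k
    fromCoefficients []       []       S = 0ℚ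
    fromCoefficients (T ∷ Ts) (c ∷ cs) S = (if does (S ≟ˢ T) then c else 0ℚ) + fromCoefficients Ts cs S

    eval-fromCoefficients : ∀ Ts cs z → eval (fromCoefficients Ts cs) z ≡ monomials Ts z ∙ cs
    eval-fromCoefficients []       []       z = ∑-zero (allSubsets k) (λ S → *-zeroˡ (monomial S z))
    eval-fromCoefficients (T ∷ Ts) (c ∷ cs) z = begin
      eval (fromCoefficients (T ∷ Ts) (c ∷ cs)) z
        ≡⟨ ∑-cong (allSubsets k) (λ S → *-distribʳ-+ (monomial S z) (if does (S ≟ˢ T) then c else 0ℚ) _) ⟩
      ∑[ S ← allSubsets k ] ((if does (S ≟ˢ T) then c else 0ℚ) * monomial S z
                             + fromCoefficients Ts cs S * monomial S z)
        ≡⟨ ∑-distrib-+ (allSubsets k) (λ S → (if does (S ≟ˢ T) then c else 0ℚ) * monomial S z) _ ⟩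
      ∑[ S ← allSubsets k ] ((if does (S ≟ˢ T) then c else 0ℚ) * monomial S z)
        + eval (fromCoefficients Ts cs) z
        ≡⟨ cong₂ _+_ (trans (Subsets.∑-indicator T c (λ S → monomial S z)) (*-comm c (monomial T z)))
                     (eval-fromCoefficients Ts cs z) ⟩
      monomial T z * c + monomials Ts z ∙ cs
        ∎
      where open ≡-Reasoning

    fromCoefficients-∉ : ∀ {S} Ts cs → S ∉ Ts → fromCoefficients Ts cs S ≡ 0ℚ
    fromCoefficients-∉         []       []       _  = refl
    fromCoefficients-∉ {S = S} (T ∷ Ts) (c ∷ cs) S∉ =
      cong₂ (λ b r → (if b then c else 0ℚ) + r) (dec-false (S ≟ˢ T) (S∉ ∘ here))
            (fromCoefficients-∉ Ts cs (S∉ ∘ there))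

  record Weights {k n} (row : Point k → Constraint n) (d : Constraint n) : Set where
    field
      weight         : Point k → ℚ
      weight-nonNeg  : ∀ x → 0ℚ ≤ weight x
      ∑-coefficients : ∀ j → Σpts k (λ x → weight x * V.lookup (proj₁ (row x)) j) ≡ V.lookup (proj₁ d) j
      ∑-bounds       : Σpts k (λ x → weight x * proj₂ (row x)) ≡ proj₂ d

  cone⇒weights : ∀ {k n} (row : Point k → Constraint n) {d} → Cone (L.map row (allPoints k)) d →
                 Weights row d
  cone⇒weights {k} row (gen c∈) with ∈-map⁻ row c∈
  ... | z , _ , refl = record
    { weight         = indicator
    ; weight-nonNeg  = indicator-nonNeg
    ; ∑-coefficients = λ j →
        trans (Points.∑-indicator z 1ℚ (λ x → V.lookup (proj₁ (row x)) j)) (*-identityˡ _)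
    ; ∑-bounds       = trans (Points.∑-indicator z 1ℚ (proj₂ ∘ row)) (*-identityˡ _)
    }
    where
    indicator : Point k → ℚ
    indicator x = if does (x ≟ᵖ z) then 1ℚ else 0ℚ
    indicator-nonNeg : ∀ x → 0ℚ ≤ indicator x
    indicator-nonNeg x = if-nonNeg (does (x ≟ᵖ z)) (<⇒≤ (positive⁻¹ 1ℚ))
  cone⇒weights {k} row (_⊕ᶜ_ {a₁ , _} {a₂ , _} c₁ c₂) = record
    { weight         = λ x → W₁.weight x + W₂.weight x
    ; weight-nonNeg  = λ x → +-mono-≤ (W₁.weight-nonNeg x) (W₂.weight-nonNeg x)
    ; ∑-coefficients = λ j → trans (split (λ x → V.lookup (proj₁ (row x)) j))
        (trans (cong₂ _+_ (W₁.∑-coefficients j) (W₂.∑-coefficients j)) (sym (V.lookup-zipWith _+_ j a₁ a₂)))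
    ; ∑-bounds       = trans (split (proj₂ ∘ row)) (cong₂ _+_ W₁.∑-bounds W₂.∑-bounds)
    }
    where
    module W₁ = Weights (cone⇒weights row c₁)
    module W₂ = Weights (cone⇒weights row c₂)
    split : ∀ f → Σpts k (λ x → (W₁.weight x + W₂.weight x) * f x)
                ≡ Σpts k (λ x → W₁.weight x * f x) + Σpts k (λ x → W₂.weight x * f x)
    split f = trans (∑-cong (allPoints k) (λ x → *-distribʳ-+ (f x) (W₁.weight x) (W₂.weight x)))
                    (∑-distrib-+ (allPoints k) _ _)
  cone⇒weights {k} row (scale {a , _} s s≥0 c) = record
    { weight         = λ x → s * W.weight x
    ; weight-nonNeg  = λ x → *-nonNeg s≥0 (W.weight-nonNeg x)
    ; ∑-coefficients = λ j → trans (pull (λ x → V.lookup (proj₁ (row x)) j))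
        (trans (cong (s *_) (W.∑-coefficients j)) (sym (V.lookup-map j (s *_) a)))
    ; ∑-bounds       = trans (pull (proj₂ ∘ row)) (cong (s *_) W.∑-bounds)
    }
    where
    module W = Weights (cone⇒weights row c)
    pull : ∀ f → Σpts k (λ x → s * W.weight x * f x) ≡ s * Σpts k (λ x → W.weight x * f x)
    pull f = trans (∑-cong (allPoints k) (λ x → *-assoc s (W.weight x) (f x)))
                   (*-distribˡ-∑ (allPoints k) s _)

  -- one unknown per monomial z^T with 1 ≤ |T| ≤ t, one constraint eval Q z ≥ threshold P δ z per point z
  module LinearProgram {k} (t : ℕ) (P : Predicate k) (δ : ℚ) where

    Low : Subset k → Set
    Low T = 1 ℕ.≤ ∣ T ∣ × ∣ T ∣ ℕ.≤ t

    low? : ∀ T → Dec (Low T)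
    low? T = 1 ℕ.≤? ∣ T ∣ ×-dec ∣ T ∣ ℕ.≤? t

    lowSubsets : List (Subset k)
    lowSubsets = L.filter low? (allSubsets k)

    row : Point k → Constraint (L.length lowSubsets)
    row z = monomials lowSubsets z , threshold P δ z

    system : List (Constraint (L.length lowSubsets))
    system = L.map row (allPoints k)

    feasible⇒separating : Feasible system →
                          Σ (MultilinearPoly k) (λ Q → Separating P δ Q × DegreeAtMost t Q)
    feasible⇒separating (cs , sat) =
      Q , threshold≤eval⇒separating {Q = Q} bound (vanish {⊥} ⊥-not-low) , degree
      where
      Q = fromCoefficients lowSubsets cs

      vanish : ∀ {S} → ¬ Low S → Q S ≡ 0ℚ
      vanish ¬low =
        fromCoefficients-∉ lowSubsets cs (¬low ∘ proj₂ ∘ ∈-filter⁻ low? {xs = allSubsets k})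

      ⊥-not-low : ¬ Low ⊥
      ⊥-not-low (1≤∣⊥∣ , _) with subst (1 ℕ.≤_) (∣⊥∣≡0 k) 1≤∣⊥∣
      ... | ()

      bound : ∀ z → threshold P δ z ≤ eval Q z
      bound z = subst (threshold P δ z ≤_) (sym (eval-fromCoefficients lowSubsets cs z))
                      (All.lookup sat (∈-map⁺ row (Points.∈-cube z)))

      degree : DegreeAtMost t Q
      degree S t<∣S∣ = vanish {S} (λ (_ , ∣S∣≤t) → ℕ.<⇒≱ t<∣S∣ ∣S∣≤t)

    refutable⇒¬far : Refutable system → ¬ DeltaFar P t δ
    refutable⇒¬far (β , β>0 , cone) =
      weights⇒¬far weight weight-nonNeg vanish (subst (0ℚ <_) (sym ∑-bounds) β>0)
      where
      open Weights (cone⇒weights row cone)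

      vanish : MomentsVanishUpTo t weight
      vanish T 1≤∣T∣ ∣T∣≤t = begin
        moment weight T
          ≡⟨ ∑-cong (allPoints k) (λ x → cong (weight x *_) (sym (lookup-monomials T∈ x))) ⟩
        Σpts k (λ x → weight x * V.lookup (monomials lowSubsets x) (index T∈))
          ≡⟨ ∑-coefficients (index T∈) ⟩
        V.lookup (V.replicate _ 0ℚ) (index T∈)
          ≡⟨ V.lookup-replicate (index T∈) 0ℚ ⟩
        0ℚ
          ∎
        where
        open ≡-Reasoning
        T∈ = ∈-filter⁺ low? (Subsets.∈-cube T) (1≤∣T∣ , ∣T∣≤t)

open import Data.Nat using (ℕ; _≤_)
open import Data.Rational using (ℚ; 0ℚ; 1ℚ; _<_)
open import Data.Product using (Σ; _×_; _,_)
open import Data.Sum using (inj₁; inj₂)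
open import Data.Empty using (⊥-elim)
open import Function.Bundles using (_⇔_; mk⇔)

lemma3p16 : (k t : ℕ) (P : Predicate k) (δ : ℚ) →
    1 ≤ t → t ≤ k → 0ℚ < δ → δ < 1ℚ →
    DeltaFar P t δ ⇔ Σ (MultilinearPoly k) (λ Q → Separating P δ Q × DegreeAtMost t Q)
lemma3p16 k t P δ _ t≤k _ _ =
  mk⇔ far⇒separating (λ (Q , separating , degree) → separating⇒far t≤k separating degree)
  where
  open LinearProgram t P δ
  far⇒separating : DeltaFar P t δ → Σ (MultilinearPoly k) (λ Q → Separating P δ Q × DegreeAtMost t Q)
  far⇒separating far with farkas system
  ... | inj₁ feasible  = feasible⇒separating feasible
  ... | inj₂ refutable = ⊥-elim (refutable⇒¬far refutable far)
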